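{- Let $a_0,\dots,a_{15}\in\mathbb{Z}$ and let $N_1,N_2,N_4,N_8,N_{16}$ be as defined in the context. The following three conditions are equivalent: (1) $D(a_0,\dots,a_{15}) = N_1N_2N_4N_8N_{16} \in 64\,\mathbb{Z}_{\rm odd}$; (2) $N_1, N_2 \in 2\,\mathbb{Z}_{\rm odd}$ and $N_4N_8N_{16} \in 16\,\mathbb{Z}_{\rm odd}$; (3) $N_1, N_2, N_4 \in 2\,\mathbb{Z}_{\rm odd}$ and $N_8N_{16}\in 8\,\mathbb{Z}_{\rm odd}$.
   Context: $D(a_0,\dots,a_{15})$ is the determinant of the $16\times16$ matrix with $(i,j)$ entry $a_{(i-j)\bmod 16}$ ($0\le i,j\le 15$). Let $f(x)=\sum_{k=0}^{15}a_kx^k$ and $\zeta_{16}=e^{2\pi\sqrt{ -1}/16}$. For each divisor $d$ of $16$, $N_d := \prod_{0\le l\le 15,\ \gcd(l,16)=d} f(\zeta_{16}^l)$ (with the convention $\gcd(0,16)=16$); each $N_d$ is an integer, and $D(a_0,\dots,a_{15})=\prod_{d\mid 16}N_d$. $\mathbb{Z}_{\rm odd}$ is the set of odd integers and $c\,\mathbb{Z}_{\rm odd}=\{cn : n \text{ odd}\}$. -}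

module Defs where

open import Data.Bool using (Bool; true; false; if_then_else_)
open import Data.Nat as ℕ using (ℕ; zero; suc; _≡ᵇ_)
open import Data.Nat.GCD using (gcd)
open import Data.Fin using (Fin; toℕ)
open import Data.Integer using (ℤ; +_; -_; _+_; _*_)
open import Data.Integer.Divisibility using (_∣_)
open import Data.List using (List; foldr; upTo)
open import Data.Product using (Σ; _×_)
open import Relation.Nullary using (¬_)
open import Relation.Binary.PropositionalEquality using (_≡_)

-- The ring ℤ[ζ₁₆] ≅ ℤ[x]/(x⁸ + 1), elements given by their 8 coefficients
-- w.r.t. the basis 1, ζ, …, ζ⁷ (ζ = ζ₁₆ = e^{2πi/16}).
R : Set
R = Fin 8 → ℤ

sumFin : ∀ {n} → (Fin n → ℤ) → ℤ
sumFin {zero}  f = + 0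
sumFin {suc n} f = f Data.Fin.zero + sumFin (λ i → f (Data.Fin.suc i))

0R : R
0R _ = + 0

1R : R
1R k = if toℕ k ≡ᵇ 0 then + 1 else + 0

ζ : R
ζ k = if toℕ k ≡ᵇ 1 then + 1 else + 0

_+R_ : R → R → R
(x +R y) k = x k + y k

scaleR : ℤ → R → R
scaleR c x k = c * x k

-- multiplication modulo x⁸ = -1
_*R_ : R → R → R
(x *R y) k = sumFin λ i → sumFin λ j →
  if ℕ._+_ (toℕ i) (toℕ j) ≡ᵇ toℕ k then x i * y j
  else if ℕ._+_ (toℕ i) (toℕ j) ≡ᵇ ℕ._+_ (toℕ k) 8 then - (x i * y j)
  else + 0

powR : R → ℕ → R
powR x zero    = 1R
powR x (suc n) = x *R powR x n

sumR : ∀ {n} → (Fin n → R) → R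
sumR {zero}  f = 0R
sumR {suc n} f = f Data.Fin.zero +R sumR (λ i → f (Data.Fin.suc i))

evalF : (Fin 16 → ℤ) → R → R
evalF a z = sumR λ k → scaleR (a k) (powR z (toℕ k))

prodN : (Fin 16 → ℤ) → ℕ → R
prodN a d = foldr (λ l acc → if gcd l 16 ≡ᵇ d then evalF a (powR ζ l) *R acc else acc)
                  1R (upTo 16)

-- N_d as an integer: the product is rational, so it is its coefficient of 1.
N : (Fin 16 → ℤ) → ℕ → ℤ
N a d = prodN a d Data.Fin.zero

InOddMul : ℤ → ℤ → Set
InOddMul c x = Σ ℤ λ n → ¬ (+ 2 ∣ n) × x ≡ c * n

Cond1 : (Fin 16 → ℤ) → Set
Cond1 a = InOddMul (+ 64) (N a 1 * N a 2 * N a 4 * N a 8 * N a 16)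

Cond2 : (Fin 16 → ℤ) → Set
Cond2 a = InOddMul (+ 2) (N a 1) × InOddMul (+ 2) (N a 2)
        × InOddMul (+ 16) (N a 4 * N a 8 * N a 16)

Cond3 : (Fin 16 → ℤ) → Set
Cond3 a = InOddMul (+ 2) (N a 1) × InOddMul (+ 2) (N a 2) × InOddMul (+ 2) (N a 4)
        × InOddMul (+ 8) (N a 8 * N a 16)

{-# OPTIONS --safe #-}

-- N_d is the product of
-- f(ζˡ) over the orbit {l : gcd(l,16) = d} of the automorphisms σ_t : ζ ↦ ζ^(2t+1); fixed by
-- all of them, it is rational, so it equals its coefficient sum S.  As x⁸ + 1 ≡ (x + 1)⁸
-- (mod 2), S is multiplicative modulo 2, and S(f(ζˡ)) ≡ f(1); hence N_d ≡ f(1)^|orbit| (mod 2).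
-- If f(1) = 2m, write f(z) = f(1) + (z − 1)Q(z).  For d = 1, 2, 4 the product of the ζˡ − 1
-- over the orbit is Φ_{16/d}(1) = 2, so ζˡ − 1 divides 2 with a cofactor w of even coefficient
-- sum (the product of the other factors), and f(ζˡ) = (ζˡ − 1)(m w + Q(ζˡ)).  Multiplying out,
-- N_d = 2q with q ≡ Q(1)^|orbit| = f′(1)^|orbit| (mod 2).  So either f(1) is odd, or f(1) and
-- f′(1) are both even (then 4 divides N₁, N₂, N₄ and 2 divides N₁₆ = f(1)), and all three
-- conditions fail; or f(1) is even and f′(1) odd, N₁, N₂, N₄ ∈ 2ℤ_odd, and each condition
-- reduces to N₈N₁₆ ∈ 8ℤ_odd.

module Submission where

open import Defs
open import Level using (0ℓ)
import Data.Integer.Properties as ℤ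
import Data.Nat.Properties as ℕ
open import Algebra.Bundles using (CommutativeRing)
open import Algebra.Structures using (IsAbelianGroup)
import Algebra.Properties.CommutativeSemigroup as CommutativeSemigroupProperties
open import Algebra.Properties.Semiring.Sum ℤ.+-*-semiring
  using (sum; ∑-distrib-+; sum-cong-≗; *-distribˡ-sum; sum-replicate-zero)
open import Data.Bool using (Bool; true; false; if_then_else_)
open import Data.Bool.Properties using (if-float)
open import Data.Empty using (⊥; ⊥-elim)
open import Data.Fin using (Fin; toℕ) renaming (zero to fz; suc to fs)
open import Data.Fin.Properties using (all?; toℕ-fromℕ<)
open import Data.Integer using (ℤ; +_; -_; _+_; _-_; _*_; _^_; 0ℤ; 1ℤ; -1ℤ; NonZero)
open import Data.Integer.Divisibility using (_∣_)
import Data.Integer.Divisibility.Signed as Signed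
import Data.Integer.DivMod as ℤ/
open import Data.Integer.Tactic.RingSolver using (solve-∀)
open import Data.List using (List; []; _∷_; _++_; foldr; map; upTo; length)
open import Data.List.Membership.Propositional using (_∈_)
open import Data.List.Membership.Propositional.Properties using (∈-∃++)
open import Data.List.Properties using (foldr-map; ≡-dec)
open import Data.List.Relation.Binary.Permutation.Propositional
  using (_↭_; ↭-sym; ↭-trans; ↭-reflexive; ↭⇒↭ₛ′)
open import Data.List.Relation.Binary.Permutation.Propositional.Properties using (map⁺; shift; ↭-length)
import Data.List.Relation.Binary.Permutation.Setoid.Properties as SetoidPermutation
open import Data.List.Relation.Unary.All using (All; []; _∷_)
import Data.List.Relation.Unary.All as All
open import Data.List.Relation.Unary.Any using (here; there)
open import Data.List.Sort.InsertionSort ℕ.≤-decTotalOrder using (sort)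
open import Data.List.Sort.InsertionSort.Properties ℕ.≤-decTotalOrder using (sort-↭)
open import Data.Nat as ℕ using (ℕ; zero; suc; _≡ᵇ_)
import Data.Nat.Divisibility as ℕ∣
open import Data.Nat.DivMod using (_%_; _mod_; m%n%n≡m%n; %-distribˡ-+)
open import Data.Nat.GCD using (gcd)
open import Data.Product using (Σ; _×_; _,_; proj₁; proj₂; map₂)
open import Data.Sum using (_⊎_; inj₁; inj₂)
import Data.Vec as Vec
import Data.Vec.Properties as Vec
open import Function.Bundles using (_⇔_; mk⇔; Equivalence)
import Function.Properties.Equivalence as ⇔
open import Relation.Binary.Bundles using (Setoid)
open import Relation.Binary.Structures using (IsEquivalence)
open import Relation.Binary.PropositionalEquality as ≡
  using (_≡_; _≗_; refl; cong; cong₂; module ≡-Reasoning)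
open import Relation.Nullary using (¬_)
open import Relation.Nullary.Decidable using (Dec; from-yes; map′)

sumFin≡sum : ∀ {n} (f : Fin n → ℤ) → sumFin f ≡ sum f
sumFin≡sum {zero}  f = refl
sumFin≡sum {suc n} f = cong (λ s → f fz + s) (sumFin≡sum (λ i → f (fs i)))

sumFin-cong : ∀ {n} {f g : Fin n → ℤ} → f ≗ g → sumFin f ≡ sumFin g
sumFin-cong {f = f} {g} f≗g =
  ≡.trans (sumFin≡sum f) (≡.trans (sum-cong-≗ f≗g) (≡.sym (sumFin≡sum g)))

sumFin-+ : ∀ {n} (f g : Fin n → ℤ) → sumFin (λ i → f i + g i) ≡ sumFin f + sumFin g
sumFin-+ f g = ≡.trans (sumFin≡sum (λ i → f i + g i))
  (≡.trans (∑-distrib-+ f g) (≡.sym (cong₂ _+_ (sumFin≡sum f) (sumFin≡sum g))))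

sumFin-*ˡ : ∀ {n} c (f : Fin n → ℤ) → sumFin (λ i → c * f i) ≡ c * sumFin f
sumFin-*ˡ c f = ≡.trans (sumFin≡sum (λ i → c * f i))
  (≡.trans (≡.sym (*-distribˡ-sum c f)) (cong (λ s → c * s) (≡.sym (sumFin≡sum f))))

sumFin-zero : ∀ n → sumFin {n} (λ _ → 0ℤ) ≡ 0ℤ
sumFin-zero n = ≡.trans (sumFin≡sum {n} (λ _ → 0ℤ)) (sum-replicate-zero n)

sumFin-const : ∀ n c → sumFin {n} (λ _ → c) ≡ + n * c
sumFin-const zero    c = refl
sumFin-const (suc n) c = begin
  c + sumFin {n} (λ _ → c)   ≡⟨ cong (λ s → c + s) (sumFin-const n c) ⟩
  c + + n * c                ≡⟨ cong (_+ + n * c) (ℤ.*-identityˡ c) ⟨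
  1ℤ * c + + n * c           ≡⟨ ℤ.*-distribʳ-+ c 1ℤ (+ n) ⟨
  + suc n * c                ∎
  where open ≡-Reasoning

infix 4 _≈_
record _≈_ (x y : R) : Set where
  constructor pointwise
  field at : ∀ k → x k ≡ y k

open _≈_

≈-isEquivalence : IsEquivalence _≈_
≈-isEquivalence = record
  { refl  = pointwise λ _ → refl
  ; sym   = λ x≈y → pointwise λ k → ≡.sym (at x≈y k)
  ; trans = λ x≈y y≈z → pointwise λ k → ≡.trans (at x≈y k) (at y≈z k)
  }

R-setoid : Setoid 0ℓ 0ℓ
R-setoid = record { isEquivalence = ≈-isEquivalence }

open Setoid R-setoid using () renaming (refl to ≈-refl; sym to ≈-sym; trans to ≈-trans)

infix 4 _≟R_
_≟R_ : (x y : R) → Dec (x ≈ y)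
x ≟R y = map′ pointwise at (all? λ k → x k ℤ.≟ y k)

negR : R → R
negR x k = - x k

_-R_ : R → R → R
x -R y = x +R negR y

+R-cong : ∀ {x x′ y y′} → x ≈ x′ → y ≈ y′ → x +R y ≈ x′ +R y′
+R-cong x≈x′ y≈y′ = pointwise λ k → cong₂ _+_ (at x≈x′ k) (at y≈y′ k)

+R-isAbelianGroup : IsAbelianGroup _≈_ _+R_ 0R negR
+R-isAbelianGroup = record
  { isGroup = record
    { isMonoid = record
      { isSemigroup = record
        { isMagma = record
          { isEquivalence = ≈-isEquivalence
          ; ∙-cong        = λ p q → pointwise λ k → cong₂ _+_ (at p k) (at q k)
          }
        ; assoc = λ x y z → pointwise λ k → ℤ.+-assoc (x k) (y k) (z k)
        }
      ; identity = (λ x → pointwise λ k → ℤ.+-identityˡ (x k)) , (λ x → pointwise λ k → ℤ.+-identityʳ (x k))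
      }
    ; inverse = (λ x → pointwise λ k → ℤ.+-inverseˡ (x k)) , (λ x → pointwise λ k → ℤ.+-inverseʳ (x k))
    ; ⁻¹-cong = λ p → pointwise λ k → cong -_ (at p k)
    }
  ; comm = λ x y → pointwise λ k → ℤ.+-comm (x k) (y k)
  }

sumR-apply : ∀ {n} (f : Fin n → R) k → sumR f k ≡ sumFin (λ i → f i k)
sumR-apply {zero}  f k = refl
sumR-apply {suc n} f k = cong (λ s → f fz k + s) (sumR-apply (λ i → f (fs i)) k)

sumR-cong : ∀ {n} {f g : Fin n → R} → (∀ i → f i ≈ g i) → sumR f ≈ sumR g
sumR-cong {f = f} {g} f≈g = pointwise λ k → begin
  sumR f k                ≡⟨ sumR-apply f k ⟩
  sumFin (λ i → f i k)    ≡⟨ sumFin-cong (λ i → at (f≈g i) k) ⟩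
  sumFin (λ i → g i k)    ≡⟨ sumR-apply g k ⟨
  sumR g k                ∎
  where open ≡-Reasoning

lincomb : ∀ {n} → (Fin n → ℤ) → (Fin n → R) → R
lincomb c v = sumR (λ k → scaleR (c k) (v k))

lincomb-apply : ∀ {n} (c : Fin n → ℤ) v j → lincomb c v j ≡ sumFin (λ k → c k * v k j)
lincomb-apply c v = sumR-apply (λ k → scaleR (c k) (v k))

lincomb-congʳ : ∀ {n} (c : Fin n → ℤ) {v w} → (∀ k → v k ≈ w k) → lincomb c v ≈ lincomb c w
lincomb-congʳ c v≈w = sumR-cong (λ k → pointwise λ j → cong (c k *_) (at (v≈w k) j))

record IsLinear (F : R → R) : Set where
  field
    ≈-cong     : ∀ {x y} → x ≈ y → F x ≈ F y
    +-homo     : ∀ x y → F (x +R y) ≈ F x +R F y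
    scale-homo : ∀ c x → F (scaleR c x) ≈ scaleR c (F x)

open IsLinear

id-linear : IsLinear (λ x → x)
id-linear = record { ≈-cong = λ p → p ; +-homo = λ _ _ → ≈-refl ; scale-homo = λ _ _ → ≈-refl }

∘-linear : ∀ {F G} → IsLinear F → IsLinear G → IsLinear (λ x → F (G x))
∘-linear {F} {G} lF lG = record
  { ≈-cong     = λ p → ≈-cong lF (≈-cong lG p)
  ; +-homo     = λ x y → ≈-trans (≈-cong lF (+-homo lG x y)) (+-homo lF (G x) (G y))
  ; scale-homo = λ c x → ≈-trans (≈-cong lF (scale-homo lG c x)) (scale-homo lF c (G x))
  }

linear-sumR : ∀ {F} → IsLinear F → ∀ {n} (f : Fin n → R) → F (sumR f) ≈ sumR (λ i → F (f i))
linear-sumR lF {zero}  f = ≈-trans (≈-cong lF (pointwise λ _ → refl)) (scale-homo lF 0ℤ 0R)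
linear-sumR {F} lF {suc n} f = ≈-trans (+-homo lF (f fz) (sumR (λ i → f (fs i))))
  (pointwise λ k → cong (λ s → F (f fz) k + s) (at (linear-sumR lF (λ i → f (fs i))) k))

linear-lincomb : ∀ {F} → IsLinear F → ∀ {n} (c : Fin n → ℤ) v →
                 F (lincomb c v) ≈ lincomb c (λ k → F (v k))
linear-lincomb lF c v = ≈-trans (linear-sumR lF (λ k → scaleR (c k) (v k)))
                                (sumR-cong (λ k → scale-homo lF (c k) (v k)))

lincomb-linear : (v : Fin 8 → R) → IsLinear (λ x → lincomb x v)
lincomb-linear v = record
  { ≈-cong     = λ p → sumR-cong (λ k → pointwise λ j → cong (_* v k j) (at p k))
  ; +-homo     = λ x y → pointwise λ j → begin
      lincomb (λ k → x k + y k) v j                       ≡⟨ lincomb-apply (λ k → x k + y k) v j ⟩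
      sumFin (λ k → (x k + y k) * v k j)                  ≡⟨ sumFin-cong (λ k → ℤ.*-distribʳ-+ (v k j) (x k) (y k)) ⟩
      sumFin (λ k → x k * v k j + y k * v k j)            ≡⟨ sumFin-+ (λ k → x k * v k j) (λ k → y k * v k j) ⟩
      sumFin (λ k → x k * v k j) + sumFin (λ k → y k * v k j)
                                                          ≡⟨ cong₂ _+_ (lincomb-apply x v j) (lincomb-apply y v j) ⟨
      lincomb x v j + lincomb y v j                       ∎
  ; scale-homo = λ c x → pointwise λ j → begin
      lincomb (λ k → c * x k) v j                         ≡⟨ lincomb-apply (λ k → c * x k) v j ⟩
      sumFin (λ k → c * x k * v k j)                      ≡⟨ sumFin-cong (λ k → ℤ.*-assoc c (x k) (v k j)) ⟩
      sumFin (λ k → c * (x k * v k j))                    ≡⟨ sumFin-*ˡ c (λ k → x k * v k j) ⟩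
      c * sumFin (λ k → x k * v k j)                      ≡⟨ cong (c *_) (lincomb-apply x v j) ⟨
      c * lincomb x v j                                   ∎
  }
  where open ≡-Reasoning

e : Fin 8 → R
e i k = if toℕ i ≡ᵇ toℕ k then 1ℤ else 0ℤ

lincomb-e : ∀ x → lincomb x e ≈ x
lincomb-e x = pointwise λ k → ≡.trans (lincomb-apply x e k) (δ x k)
  where
  δ : ∀ {n} (x : Fin n → ℤ) k → sumFin (λ i → x i * (if toℕ i ≡ᵇ toℕ k then 1ℤ else 0ℤ)) ≡ x k
  δ {suc n} x fz = begin
    x fz * 1ℤ + sumFin (λ i → x (fs i) * 0ℤ)
      ≡⟨ cong₂ _+_ (ℤ.*-identityʳ (x fz)) (sumFin-cong (λ i → ℤ.*-zeroʳ (x (fs i)))) ⟩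
    x fz + sumFin {n} (λ _ → 0ℤ)   ≡⟨ cong (λ s → x fz + s) (sumFin-zero n) ⟩
    x fz + 0ℤ                      ≡⟨ ℤ.+-identityʳ (x fz) ⟩
    x fz                           ∎
    where open ≡-Reasoning
  δ {suc n} x (fs k) = begin
    x fz * 0ℤ + rest   ≡⟨ cong (_+ rest) (ℤ.*-zeroʳ (x fz)) ⟩
    0ℤ + rest          ≡⟨ ℤ.+-identityˡ rest ⟩
    rest               ≡⟨ δ (λ i → x (fs i)) k ⟩
    x (fs k)           ∎
    where
    open ≡-Reasoning
    rest = sumFin (λ i → x (fs i) * (if toℕ i ≡ᵇ toℕ k then 1ℤ else 0ℤ))

linear-ext : ∀ {F G} → IsLinear F → IsLinear G → (∀ i → F (e i) ≈ G (e i)) → ∀ x → F x ≈ G x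
linear-ext {F} {G} lF lG F≈G x = begin
  F x                         ≈⟨ ≈-cong lF (lincomb-e x) ⟨
  F (lincomb x e)             ≈⟨ linear-lincomb lF x e ⟩
  lincomb x (λ i → F (e i))   ≈⟨ lincomb-congʳ x F≈G ⟩
  lincomb x (λ i → G (e i))   ≈⟨ linear-lincomb lG x e ⟨
  G (lincomb x e)             ≈⟨ ≈-cong lG (lincomb-e x) ⟩
  G x                         ∎
  where open import Relation.Binary.Reasoning.Setoid R-setoid

bilinear-ext : ∀ {F G : R → R → R} →
               (∀ y → IsLinear (λ x → F x y)) → (∀ x → IsLinear (F x)) →
               (∀ y → IsLinear (λ x → G x y)) → (∀ x → IsLinear (G x)) →
               (∀ i j → F (e i) (e j) ≈ G (e i) (e j)) → ∀ x y → F x y ≈ G x y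
bilinear-ext Fˡ Fʳ Gˡ Gʳ F≈G x y =
  linear-ext (Fˡ y) (Gˡ y) (λ i → linear-ext (Fʳ (e i)) (Gʳ (e i)) (F≈G i) y) x

-- The ring ℤ[ζ₁₆]

-- the structure constants of _*R_: (x *R y) k is, by definition, Σκ k (λ i j → x i * y j)
κ : Fin 8 → Fin 8 → Fin 8 → ℤ → ℤ
κ i j k v = if toℕ i ℕ.+ toℕ j ≡ᵇ toℕ k then v
            else if toℕ i ℕ.+ toℕ j ≡ᵇ toℕ k ℕ.+ 8 then - v else 0ℤ

κ-+ : ∀ i j k v w → κ i j k (v + w) ≡ κ i j k v + κ i j k w
κ-+ i j k v w with toℕ i ℕ.+ toℕ j ≡ᵇ toℕ k | toℕ i ℕ.+ toℕ j ≡ᵇ toℕ k ℕ.+ 8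
... | true  | _     = refl
... | false | true  = ℤ.neg-distrib-+ v w
... | false | false = refl

κ-* : ∀ i j k c v → κ i j k (c * v) ≡ c * κ i j k v
κ-* i j k c v with toℕ i ℕ.+ toℕ j ≡ᵇ toℕ k | toℕ i ℕ.+ toℕ j ≡ᵇ toℕ k ℕ.+ 8
... | true  | _     = refl
... | false | true  = ℤ.neg-distribʳ-* c v
... | false | false = ≡.sym (ℤ.*-zeroʳ c)

Σκ : Fin 8 → (Fin 8 → Fin 8 → ℤ) → ℤ
Σκ k P = sumFin (λ i → sumFin (λ j → κ i j k (P i j)))

Σκ-cong : ∀ k {P Q} → (∀ i j → P i j ≡ Q i j) → Σκ k P ≡ Σκ k Q
Σκ-cong k P≡Q = sumFin-cong (λ i → sumFin-cong (λ j → cong (κ i j k) (P≡Q i j)))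

Σκ-+ : ∀ k P Q → Σκ k (λ i j → P i j + Q i j) ≡ Σκ k P + Σκ k Q
Σκ-+ k P Q = begin
  Σκ k (λ i j → P i j + Q i j)
    ≡⟨ sumFin-cong (λ i → ≡.trans (sumFin-cong (λ j → κ-+ i j k (P i j) (Q i j)))
                                  (sumFin-+ (λ j → κ i j k (P i j)) (λ j → κ i j k (Q i j)))) ⟩
  sumFin (λ i → sumFin (λ j → κ i j k (P i j)) + sumFin (λ j → κ i j k (Q i j)))
    ≡⟨ sumFin-+ (λ i → sumFin (λ j → κ i j k (P i j))) (λ i → sumFin (λ j → κ i j k (Q i j))) ⟩
  Σκ k P + Σκ k Q ∎
  where open ≡-Reasoning

Σκ-* : ∀ k c P → Σκ k (λ i j → c * P i j) ≡ c * Σκ k P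
Σκ-* k c P = begin
  Σκ k (λ i j → c * P i j)
    ≡⟨ sumFin-cong (λ i → ≡.trans (sumFin-cong (λ j → κ-* i j k c (P i j)))
                                  (sumFin-*ˡ c (λ j → κ i j k (P i j)))) ⟩
  sumFin (λ i → c * sumFin (λ j → κ i j k (P i j)))
    ≡⟨ sumFin-*ˡ c (λ i → sumFin (λ j → κ i j k (P i j))) ⟩
  c * Σκ k P ∎
  where open ≡-Reasoning

*R-linearˡ : ∀ y → IsLinear (_*R y)
*R-linearˡ y = record
  { ≈-cong     = λ p → pointwise λ k → Σκ-cong k (λ i j → cong (_* y j) (at p i))
  ; +-homo     = λ x x′ → pointwise λ k →
      ≡.trans (Σκ-cong k (λ i j → ℤ.*-distribʳ-+ (y j) (x i) (x′ i)))
              (Σκ-+ k (λ i j → x i * y j) (λ i j → x′ i * y j))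
  ; scale-homo = λ c x → pointwise λ k →
      ≡.trans (Σκ-cong k (λ i j → ℤ.*-assoc c (x i) (y j))) (Σκ-* k c (λ i j → x i * y j))
  }

*R-linearʳ : ∀ x → IsLinear (x *R_)
*R-linearʳ x = record
  { ≈-cong     = λ p → pointwise λ k → Σκ-cong k (λ i j → cong (x i *_) (at p j))
  ; +-homo     = λ y y′ → pointwise λ k →
      ≡.trans (Σκ-cong k (λ i j → ℤ.*-distribˡ-+ (x i) (y j) (y′ j)))
              (Σκ-+ k (λ i j → x i * y j) (λ i j → x i * y′ j))
  ; scale-homo = λ c y → pointwise λ k →
      ≡.trans (Σκ-cong k (λ i j → x∙yz≈y∙xz (x i) c (y j))) (Σκ-* k c (λ i j → x i * y j))
  }
  where open CommutativeSemigroupProperties ℤ.*-commutativeSemigroup using (x∙yz≈y∙xz)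

*R-cong : ∀ {x x′ y y′} → x ≈ x′ → y ≈ y′ → x *R y ≈ x′ *R y′
*R-cong {x′ = x′} {y = y} x≈x′ y≈y′ =
  ≈-trans (≈-cong (*R-linearˡ y) x≈x′) (≈-cong (*R-linearʳ x′) y≈y′)

-- ζ^ᵣ r is ζʳ for r < 16, written out using ζ⁸ = -1
ζ^ᵣ : ℕ → R
ζ^ᵣ r k = if r ≡ᵇ toℕ k then 1ℤ else if r ≡ᵇ toℕ k ℕ.+ 8 then -1ℤ else 0ℤ

ζ^ : ℕ → R
ζ^ n = ζ^ᵣ (n % 16)

ζ^-mod : ∀ m n → m % 16 ≡ n % 16 → ζ^ m ≈ ζ^ n
ζ^-mod m n m≡n = pointwise λ k → cong (λ r → ζ^ᵣ r k) m≡n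

ζ^-≡ : ∀ {m n} → m ≡ n → ζ^ m ≈ ζ^ n
ζ^-≡ {m} {n} m≡n = ζ^-mod m n (cong (_% 16) m≡n)

toℕ-mod : ∀ n → toℕ (n mod 16) ≡ n % 16
toℕ-mod n = toℕ-fromℕ< _

ζ^-residue : ∀ n → ζ^ n ≈ ζ^ (toℕ (n mod 16))
ζ^-residue n = ζ^-mod n (toℕ (n mod 16)) (≡.sym (≡.trans (cong (_% 16) (toℕ-mod n)) (m%n%n≡m%n n 16)))

ζ^-table : ∀ (r s : Fin 16) → ζ^ (toℕ r) *R ζ^ (toℕ s) ≈ ζ^ (toℕ r ℕ.+ toℕ s)
ζ^-table = from-yes (all? λ (r : Fin 16) → all? λ (s : Fin 16) →
  ζ^ (toℕ r) *R ζ^ (toℕ s) ≟R ζ^ (toℕ r ℕ.+ toℕ s))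

ζ^-+ : ∀ m n → ζ^ m *R ζ^ n ≈ ζ^ (m ℕ.+ n)
ζ^-+ m n = begin
  ζ^ m *R ζ^ n                                ≈⟨ *R-cong (ζ^-residue m) (ζ^-residue n) ⟩
  ζ^ (toℕ (m mod 16)) *R ζ^ (toℕ (n mod 16))  ≈⟨ ζ^-table (m mod 16) (n mod 16) ⟩
  ζ^ (toℕ (m mod 16) ℕ.+ toℕ (n mod 16))
    ≈⟨ ζ^-mod (toℕ (m mod 16) ℕ.+ toℕ (n mod 16)) (m ℕ.+ n) residues-+ ⟩
  ζ^ (m ℕ.+ n)                                ∎
  where
  open import Relation.Binary.Reasoning.Setoid R-setoid
  residues-+ : (toℕ (m mod 16) ℕ.+ toℕ (n mod 16)) % 16 ≡ (m ℕ.+ n) % 16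
  residues-+ = ≡.trans (cong₂ (λ a b → (a ℕ.+ b) % 16) (toℕ-mod m) (toℕ-mod n))
                       (≡.sym (%-distribˡ-+ m n 16))

e≈ζ^ : ∀ i → e i ≈ ζ^ (toℕ i)
e≈ζ^ = from-yes (all? λ i → e i ≟R ζ^ (toℕ i))

1R≈ζ^0 : 1R ≈ ζ^ 0
1R≈ζ^0 = from-yes (1R ≟R ζ^ 0)

ζ≈ζ^1 : ζ ≈ ζ^ 1
ζ≈ζ^1 = from-yes (ζ ≟R ζ^ 1)

e*e : ∀ i j → e i *R e j ≈ ζ^ (toℕ i ℕ.+ toℕ j)
e*e i j = ≈-trans (*R-cong (e≈ζ^ i) (e≈ζ^ j)) (ζ^-+ (toℕ i) (toℕ j))

*R-comm : ∀ x y → x *R y ≈ y *R x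
*R-comm = bilinear-ext *R-linearˡ *R-linearʳ *R-linearʳ *R-linearˡ λ i j →
  ≈-trans (e*e i j) (≈-trans (ζ^-≡ (ℕ.+-comm (toℕ i) (toℕ j))) (≈-sym (e*e j i)))

*R-assoc : ∀ x y z → (x *R y) *R z ≈ x *R (y *R z)
*R-assoc x y z = linear-ext (∘-linear (*R-linearˡ z) (*R-linearˡ y)) (*R-linearˡ (y *R z))
  (λ i → bilinear-ext
     (λ z → ∘-linear (*R-linearˡ z) (*R-linearʳ (e i))) (λ y → *R-linearʳ (e i *R y))
     (λ z → ∘-linear (*R-linearʳ (e i)) (*R-linearˡ z)) (λ y → ∘-linear (*R-linearʳ (e i)) (*R-linearʳ y))
     (λ j k → begin
        (e i *R e j) *R e k                 ≈⟨ *R-cong (e*e i j) (e≈ζ^ k) ⟩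
        ζ^ (toℕ i ℕ.+ toℕ j) *R ζ^ (toℕ k)  ≈⟨ ζ^-+ (toℕ i ℕ.+ toℕ j) (toℕ k) ⟩
        ζ^ (toℕ i ℕ.+ toℕ j ℕ.+ toℕ k)      ≈⟨ ζ^-≡ (ℕ.+-assoc (toℕ i) (toℕ j) (toℕ k)) ⟩
        ζ^ (toℕ i ℕ.+ (toℕ j ℕ.+ toℕ k))    ≈⟨ ζ^-+ (toℕ i) (toℕ j ℕ.+ toℕ k) ⟨
        ζ^ (toℕ i) *R ζ^ (toℕ j ℕ.+ toℕ k)  ≈⟨ *R-cong (e≈ζ^ i) (e*e j k) ⟨
        e i *R (e j *R e k)                 ∎)
     y z) x
  where open import Relation.Binary.Reasoning.Setoid R-setoid

*R-identityˡ : ∀ x → 1R *R x ≈ x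
*R-identityˡ = linear-ext (*R-linearʳ 1R) id-linear λ i →
  ≈-trans (*R-cong 1R≈ζ^0 (e≈ζ^ i)) (≈-trans (ζ^-+ 0 (toℕ i)) (≈-sym (e≈ζ^ i)))

ℤ[ζ₁₆] : CommutativeRing 0ℓ 0ℓ
ℤ[ζ₁₆] = record
  { Carrier           = R
  ; _≈_               = _≈_
  ; _+_               = _+R_
  ; _*_               = _*R_
  ; -_                = negR
  ; 0#                = 0R
  ; 1#                = 1R
  ; isCommutativeRing = record
    { isRing = record
      { +-isAbelianGroup = +R-isAbelianGroup
      ; *-cong           = *R-cong
      ; *-assoc          = *R-assoc
      ; *-identity       = *R-identityˡ , λ x → ≈-trans (*R-comm x 1R) (*R-identityˡ x)
      ; distrib          = (λ x y z → +-homo (*R-linearʳ x) y z) , (λ x y z → +-homo (*R-linearˡ x) y z)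
      }
    ; *-comm = *R-comm
    }
  }

open CommutativeRing ℤ[ζ₁₆] using (*-isCommutativeMonoid; *-commutativeSemigroup)

powR-cong : ∀ {x y} n → x ≈ y → powR x n ≈ powR y n
powR-cong zero    x≈y = ≈-refl
powR-cong (suc n) x≈y = *R-cong x≈y (powR-cong n x≈y)

powR-ζ^ : ∀ m n → powR (ζ^ m) n ≈ ζ^ (m ℕ.* n)
powR-ζ^ m zero    = ≈-trans 1R≈ζ^0 (ζ^-≡ (≡.sym (ℕ.*-zeroʳ m)))
powR-ζ^ m (suc n) = ≈-trans (≈-cong (*R-linearʳ (ζ^ m)) (powR-ζ^ m n))
                            (≈-trans (ζ^-+ m (m ℕ.* n)) (ζ^-≡ (≡.sym (ℕ.*-suc m n))))

powR-ζ : ∀ n → powR ζ n ≈ ζ^ n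
powR-ζ n = ≈-trans (powR-cong n ζ≈ζ^1) (≈-trans (powR-ζ^ 1 n) (ζ^-≡ (ℕ.*-identityˡ n)))

-- Implicit arguments standing for elements of R are given explicitly whenever the expected type
-- involves _*R_, evalF or ∏: inferring them makes Agda normalise those (exponentially large) terms.
evalF-cong : ∀ a {z z′} → z ≈ z′ → evalF a z ≈ evalF a z′
evalF-cong a {z} {z′} z≈z′ =
  lincomb-congʳ a {λ k → powR z (toℕ k)} {λ k → powR z′ (toℕ k)} (λ k → powR-cong (toℕ k) z≈z′)

∏ : (ℕ → R) → List ℕ → R
∏ u = foldr (λ l acc → u l *R acc) 1R

∏-cong : ∀ {u v} L → (∀ l → u l ≈ v l) → ∏ u L ≈ ∏ v L
∏-cong []      u≈v = ≈-refl
∏-cong {u} {v} (l ∷ L) u≈v = *R-cong {u l} {v l} {∏ u L} {∏ v L} (u≈v l) (∏-cong L u≈v)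

∏-map : ∀ u (g : ℕ → ℕ) L → ∏ u (map g L) ≡ ∏ (λ l → u (g l)) L
∏-map u g = foldr-map (λ x acc → u x *R acc) g 1R

∏-↭ : ∀ u {L M} → L ↭ M → ∏ u L ≈ ∏ u M
∏-↭ u {L} {M} L↭M = begin
  ∏ u L                    ≡⟨ foldr-map _*R_ u 1R L ⟨
  foldr _*R_ 1R (map u L)  ≈⟨ foldr-commMonoid *-isCommutativeMonoid (↭⇒↭ₛ′ ≈-isEquivalence (map⁺ u L↭M)) ⟩
  foldr _*R_ 1R (map u M)  ≡⟨ foldr-map _*R_ u 1R M ⟩
  ∏ u M                    ∎
  where
  open import Relation.Binary.Reasoning.Setoid R-setoid
  open SetoidPermutation R-setoid using (foldr-commMonoid)

select : (ℕ → Bool) → List ℕ → List ℕ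
select p = foldr (λ l ls → if p l then l ∷ ls else ls) []

∏-select : ∀ u p L → foldr (λ l acc → if p l then u l *R acc else acc) 1R L ≡ ∏ u (select p L)
∏-select u p []      = refl
∏-select u p (l ∷ L) = ≡.trans (cong (λ acc → if p l then u l *R acc else acc) (∏-select u p L))
                               (≡.sym (if-float (∏ u) (p l)))

orbit : ℕ → List ℕ
orbit d = select (λ l → gcd l 16 ≡ᵇ d) (upTo 16)

prodN≡∏ : ∀ a d → prodN a d ≡ ∏ (λ l → evalF a (powR ζ l)) (orbit d)
prodN≡∏ a d = ∏-select (λ l → evalF a (powR ζ l)) (λ l → gcd l 16 ≡ᵇ d) (upTo 16)

-- Galois conjugation: the N_d are rational

-- σ t is the automorphism ζ ↦ ζ^(2t+1) of ℤ[ζ₁₆]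
unit : Fin 8 → ℕ
unit t = suc (2 ℕ.* toℕ t)

σ : Fin 8 → R → R
σ t x = lincomb x (λ k → ζ^ (unit t ℕ.* toℕ k))

σ-linear : ∀ t → IsLinear (σ t)
σ-linear t = lincomb-linear (λ k → ζ^ (unit t ℕ.* toℕ k))

σ-1 : ∀ t → σ t 1R ≈ 1R
σ-1 = from-yes (all? λ t → σ t 1R ≟R 1R)

σ-ζ : ∀ t → σ t ζ ≈ ζ^ (unit t)
σ-ζ = from-yes (all? λ t → σ t ζ ≟R ζ^ (unit t))

σ-e*e : ∀ t i j → σ t (e i *R e j) ≈ σ t (e i) *R σ t (e j)
σ-e*e = from-yes (all? λ t → all? λ i → all? λ j → σ t (e i *R e j) ≟R σ t (e i) *R σ t (e j))

σ-* : ∀ t x y → σ t (x *R y) ≈ σ t x *R σ t y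
σ-* t = bilinear-ext
  (λ y → ∘-linear (σ-linear t) (*R-linearˡ y)) (λ x → ∘-linear (σ-linear t) (*R-linearʳ x))
  (λ y → ∘-linear (*R-linearˡ (σ t y)) (σ-linear t)) (λ x → ∘-linear (*R-linearʳ (σ t x)) (σ-linear t))
  (σ-e*e t)

σ-powR : ∀ t x n → σ t (powR x n) ≈ powR (σ t x) n
σ-powR t x zero    = σ-1 t
σ-powR t x (suc n) = ≈-trans (σ-* t x (powR x n))
  (≈-cong (*R-linearʳ (σ t x)) {σ t (powR x n)} {powR (σ t x) n} (σ-powR t x n))

σ-∏ : ∀ t u L → σ t (∏ u L) ≈ ∏ (λ l → σ t (u l)) L
σ-∏ t u []      = σ-1 t
σ-∏ t u (l ∷ L) = ≈-trans (σ-* t (u l) (∏ u L))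
  (≈-cong (*R-linearʳ (σ t (u l))) {σ t (∏ u L)} {∏ (λ l → σ t (u l)) L} (σ-∏ t u L))

σ-evalF : ∀ t a z → σ t (evalF a z) ≈ evalF a (σ t z)
σ-evalF t a z = ≈-trans (linear-lincomb (σ-linear t) a (λ k → powR z (toℕ k)))
  (lincomb-congʳ a {λ k → σ t (powR z (toℕ k))} {λ k → powR (σ t z) (toℕ k)} (λ k → σ-powR t z (toℕ k)))

σ-powR-ζ : ∀ t l → σ t (powR ζ l) ≈ powR ζ (unit t ℕ.* l % 16)
σ-powR-ζ t l = begin
  σ t (powR ζ l)              ≈⟨ σ-powR t ζ l ⟩
  powR (σ t ζ) l              ≈⟨ powR-cong {σ t ζ} {ζ^ (unit t)} l (σ-ζ t) ⟩
  powR (ζ^ (unit t)) l        ≈⟨ powR-ζ^ (unit t) l ⟩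
  ζ^ (unit t ℕ.* l)
    ≈⟨ ζ^-mod (unit t ℕ.* l) (unit t ℕ.* l % 16) (≡.sym (m%n%n≡m%n (unit t ℕ.* l) 16)) ⟩
  ζ^ (unit t ℕ.* l % 16)      ≈⟨ powR-ζ (unit t ℕ.* l % 16) ⟨
  powR ζ (unit t ℕ.* l % 16)  ∎
  where open import Relation.Binary.Reasoning.Setoid R-setoid

σ-evalF-ζ : ∀ t a l → σ t (evalF a (powR ζ l)) ≈ evalF a (powR ζ (unit t ℕ.* l % 16))
σ-evalF-ζ t a l = ≈-trans (σ-evalF t a (powR ζ l))
  (evalF-cong a {σ t (powR ζ l)} {powR ζ (unit t ℕ.* l % 16)} (σ-powR-ζ t l))

sumR-+ : ∀ {n} (f g : Fin n → R) → sumR (λ t → f t +R g t) ≈ sumR f +R sumR g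
sumR-+ f g = pointwise λ k → begin
  sumR (λ t → f t +R g t) k                    ≡⟨ sumR-apply (λ t → f t +R g t) k ⟩
  sumFin (λ t → f t k + g t k)                 ≡⟨ sumFin-+ (λ t → f t k) (λ t → g t k) ⟩
  sumFin (λ t → f t k) + sumFin (λ t → g t k)  ≡⟨ cong₂ _+_ (sumR-apply f k) (sumR-apply g k) ⟨
  sumR f k + sumR g k                          ∎
  where open ≡-Reasoning

sumR-scale : ∀ {n} c (f : Fin n → R) → sumR (λ t → scaleR c (f t)) ≈ scaleR c (sumR f)
sumR-scale c f = pointwise λ k → begin
  sumR (λ t → scaleR c (f t)) k   ≡⟨ sumR-apply (λ t → scaleR c (f t)) k ⟩
  sumFin (λ t → c * f t k)        ≡⟨ sumFin-*ˡ c (λ t → f t k) ⟩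
  c * sumFin (λ t → f t k)        ≡⟨ cong (c *_) (sumR-apply f k) ⟨
  c * sumR f k                    ∎
  where open ≡-Reasoning

sumR-linear : ∀ {n} {F : Fin n → R → R} → (∀ t → IsLinear (F t)) → IsLinear (λ x → sumR (λ t → F t x))
sumR-linear {F = F} lF = record
  { ≈-cong     = λ x≈y → sumR-cong (λ t → ≈-cong (lF t) x≈y)
  ; +-homo     = λ x y → ≈-trans (sumR-cong (λ t → +-homo (lF t) x y)) (sumR-+ (λ t → F t x) (λ t → F t y))
  ; scale-homo = λ c x → ≈-trans (sumR-cong (λ t → scale-homo (lF t) c x)) (sumR-scale c (λ t → F t x))
  }

trace : R → R
trace x = scaleR (+ 8 * x fz) 1R

trace-linear : IsLinear trace
trace-linear = record
  { ≈-cong     = λ x≈y → pointwise λ k → cong (λ c → + 8 * c * 1R k) (at x≈y fz)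
  ; +-homo     = λ x y → pointwise λ k → distrib (x fz) (y fz) (1R k)
  ; scale-homo = λ c x → pointwise λ k → swap c (x fz) (1R k)
  }
  where
  distrib : ∀ a b o → + 8 * (a + b) * o ≡ + 8 * a * o + + 8 * b * o
  distrib = solve-∀
  swap : ∀ c a o → + 8 * (c * a) * o ≡ c * (+ 8 * a * o)
  swap = solve-∀

∑σ≈trace : ∀ x → sumR (λ t → σ t x) ≈ trace x
∑σ≈trace = linear-ext (sumR-linear σ-linear) trace-linear
  (from-yes (all? λ i → sumR (λ t → σ t (e i)) ≟R trace (e i)))

IsRational : R → Set
IsRational z = ∀ j → z (fs j) ≡ 0ℤ

fixed⇒rational : ∀ z → (∀ t → σ t z ≈ z) → IsRational z
fixed⇒rational z fixed j = ℤ.*-cancelˡ-≡ (+ 8) (z (fs j)) 0ℤ (begin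
  + 8 * z (fs j)               ≡⟨ sumFin-const 8 (z (fs j)) ⟨
  sumFin {8} (λ _ → z (fs j)) ≡⟨ sumFin-cong (λ t → ≡.sym (at (fixed t) (fs j))) ⟩
  sumFin (λ t → σ t z (fs j))  ≡⟨ sumR-apply (λ t → σ t z) (fs j) ⟨
  sumR (λ t → σ t z) (fs j)    ≡⟨ at (∑σ≈trace z) (fs j) ⟩
  + 8 * z fz * 0ℤ              ≡⟨ ℤ.*-zeroʳ (+ 8 * z fz) ⟩
  0ℤ                           ≡⟨ ℤ.*-zeroʳ (+ 8) ⟨
  + 8 * 0ℤ                     ∎)
  where open ≡-Reasoning

Stable : List ℕ → Set
Stable L = ∀ t → map (λ l → unit t ℕ.* l % 16) L ↭ L

divisors : List ℕ
divisors = 1 ∷ 2 ∷ 4 ∷ 8 ∷ 16 ∷ []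

orbit-stable : ∀ {d} → d ∈ divisors → Stable (orbit d)
orbit-stable d∈ t = ↭-by-sorting (All.lookup sorted-images d∈ t)
  where
  ↭-by-sorting : ∀ {xs ys} → sort xs ≡ sort ys → xs ↭ ys
  ↭-by-sorting {xs} {ys} eq = ↭-trans (↭-sym (sort-↭ xs)) (↭-trans (↭-reflexive eq) (sort-↭ ys))
  sorted-images : All (λ d → ∀ t → sort (map (λ l → unit t ℕ.* l % 16) (orbit d)) ≡ sort (orbit d)) divisors
  sorted-images = from-yes (All.all? (λ d → all? λ t →
    ≡-dec ℕ._≟_ (sort (map (λ l → unit t ℕ.* l % 16) (orbit d))) (sort (orbit d))) divisors)

∏-orbit-rational : ∀ a {L} → Stable L → IsRational (∏ (λ l → evalF a (powR ζ l)) L)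
∏-orbit-rational a {L} stable = fixed⇒rational (∏ f[ζ^] L) λ t → begin
  σ t (∏ f[ζ^] L)                                   ≈⟨ σ-∏ t f[ζ^] L ⟩
  ∏ (λ l → σ t (f[ζ^] l)) L
    ≈⟨ ∏-cong {λ l → σ t (f[ζ^] l)} {λ l → f[ζ^] (unit t ℕ.* l % 16)} L (σ-evalF-ζ t a) ⟩
  ∏ (λ l → f[ζ^] (unit t ℕ.* l % 16)) L             ≡⟨ ∏-map f[ζ^] (λ l → unit t ℕ.* l % 16) L ⟨
  ∏ f[ζ^] (map (λ l → unit t ℕ.* l % 16) L)         ≈⟨ ∏-↭ f[ζ^] (stable t) ⟩
  ∏ f[ζ^] L                                         ∎
  where
  open import Relation.Binary.Reasoning.Setoid R-setoid
  f[ζ^] : ℕ → R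
  f[ζ^] l = evalF a (powR ζ l)

-- Congruence modulo 2

infix 4 _≡₂_ _≡₂?_
record _≡₂_ (a b : ℤ) : Set where
  constructor mod₂
  field 2∣a-b : + 2 Signed.∣ a - b

_≡₂?_ : ∀ a b → Dec (a ≡₂ b)
a ≡₂? b = map′ mod₂ _≡₂_.2∣a-b (+ 2 Signed.∣? a - b)

≡₂-reflexive : ∀ {a b} → a ≡ b → a ≡₂ b
≡₂-reflexive {a} refl = mod₂ (Signed.divides 0ℤ (ℤ.+-inverseʳ a))

≡₂-refl : ∀ {a} → a ≡₂ a
≡₂-refl = ≡₂-reflexive refl

≡₂-sym : ∀ {a b} → a ≡₂ b → b ≡₂ a
≡₂-sym {a} {b} (mod₂ 2∣a-b) = mod₂ (≡.subst (+ 2 Signed.∣_) (negate a b) (Signed.∣m⇒∣-m 2∣a-b))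
  where
  negate : ∀ a b → - (a - b) ≡ b - a
  negate = solve-∀

≡₂-trans : ∀ {a b c} → a ≡₂ b → b ≡₂ c → a ≡₂ c
≡₂-trans {a} {b} {c} (mod₂ 2∣a-b) (mod₂ 2∣b-c) =
  mod₂ (≡.subst (+ 2 Signed.∣_) (telescope a b c) (Signed.∣m∣n⇒∣m+n 2∣a-b 2∣b-c))
  where
  telescope : ∀ a b c → (a - b) + (b - c) ≡ a - c
  telescope = solve-∀

≡₂-+ : ∀ {a b c d} → a ≡₂ b → c ≡₂ d → a + c ≡₂ b + d
≡₂-+ {a} {b} {c} {d} (mod₂ 2∣a-b) (mod₂ 2∣c-d) =
  mod₂ (≡.subst (+ 2 Signed.∣_) (regroup a b c d) (Signed.∣m∣n⇒∣m+n 2∣a-b 2∣c-d))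
  where
  regroup : ∀ a b c d → (a - b) + (c - d) ≡ (a + c) - (b + d)
  regroup = solve-∀

≡₂-* : ∀ {a b c d} → a ≡₂ b → c ≡₂ d → a * c ≡₂ b * d
≡₂-* {a} {b} {c} {d} (mod₂ 2∣a-b) (mod₂ 2∣c-d) = mod₂ (≡.subst (+ 2 Signed.∣_) (regroup a b c d)
  (Signed.∣m∣n⇒∣m+n (Signed.∣m⇒∣m*n c 2∣a-b) (Signed.∣n⇒∣m*n b 2∣c-d)))
  where
  regroup : ∀ a b c d → (a - b) * c + b * (c - d) ≡ a * c - b * d
  regroup = solve-∀

≡₂-^ : ∀ {a b} n → a ≡₂ b → a ^ n ≡₂ b ^ n
≡₂-^ zero    a≡₂b = ≡₂-refl
≡₂-^ (suc n) a≡₂b = ≡₂-* a≡₂b (≡₂-^ n a≡₂b)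

≡₂-weighted-sum : ∀ {n} (c s t : Fin n → ℤ) → (∀ k → s k ≡₂ t k) →
                  sumFin (λ k → c k * s k) ≡₂ sumFin (λ k → c k * t k)
≡₂-weighted-sum {zero}  c s t s≡₂t = ≡₂-refl
≡₂-weighted-sum {suc n} c s t s≡₂t = ≡₂-+ (≡₂-* (≡₂-refl {c fz}) (s≡₂t fz))
  (≡₂-weighted-sum (λ k → c (fs k)) (λ k → s (fs k)) (λ k → t (fs k)) (λ k → s≡₂t (fs k)))

≡₂-setoid : Setoid 0ℓ 0ℓ
≡₂-setoid = record
  { Carrier       = ℤ
  ; _≈_           = _≡₂_
  ; isEquivalence = record { refl = ≡₂-refl ; sym = ≡₂-sym ; trans = ≡₂-trans }
  }

parity : ∀ x → x ≡₂ 0ℤ ⊎ x ≡₂ 1ℤ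
parity x with x ℤ/.% + 2 | ℤ/.n%d<d x (+ 2) | ℤ/.a≡a%n+[a/n]*n x (+ 2)
... | 0           | _               | x≡0+q2 = inj₁ (mod₂ (Signed.divides (x ℤ/./ + 2)
  (≡.trans (ℤ.+-identityʳ x) (≡.trans x≡0+q2 (ℤ.+-identityˡ (x ℤ/./ + 2 * + 2))))))
... | 1           | _               | x≡1+q2 = inj₂ (mod₂ (Signed.divides (x ℤ/./ + 2)
  (≡.trans (cong (_- 1ℤ) x≡1+q2) (cancel (x ℤ/./ + 2 * + 2)))))
  where
  cancel : ∀ t → 1ℤ + t - 1ℤ ≡ t
  cancel = solve-∀
... | suc (suc _) | ℕ.s≤s (ℕ.s≤s ()) | _

0≢₂1 : ¬ 0ℤ ≡₂ 1ℤ
0≢₂1 (mod₂ 2∣-1) with ℕ∣.∣⇒≤ (Signed.∣⇒∣ᵤ 2∣-1)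
... | ℕ.s≤s ()

even-odd-absurd : ∀ {x} → x ≡₂ 0ℤ → x ≡₂ 1ℤ → ⊥
even-odd-absurd x≡₂0 x≡₂1 = 0≢₂1 (≡₂-trans (≡₂-sym x≡₂0) x≡₂1)

Odd : ℤ → Set
Odd n = ¬ (+ 2 ∣ n)

∣⇔≡₂0 : ∀ {x} → + 2 ∣ x ⇔ x ≡₂ 0ℤ
∣⇔≡₂0 {x} = mk⇔
  (λ 2∣x → mod₂ (≡.subst (+ 2 Signed.∣_) (≡.sym (ℤ.+-identityʳ x)) (Signed.∣ᵤ⇒∣ 2∣x)))
  (λ { (mod₂ 2∣x-0) → Signed.∣⇒∣ᵤ (≡.subst (+ 2 Signed.∣_) (ℤ.+-identityʳ x) 2∣x-0) })

Odd⇔≡₂1 : ∀ {x} → Odd x ⇔ x ≡₂ 1ℤ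
Odd⇔≡₂1 {x} = mk⇔ odd⇒ ⇒odd
  where
  odd⇒ : Odd x → x ≡₂ 1ℤ
  odd⇒ x-odd with parity x
  ... | inj₁ x≡₂0 = ⊥-elim (x-odd (Equivalence.from ∣⇔≡₂0 x≡₂0))
  ... | inj₂ x≡₂1 = x≡₂1
  ⇒odd : x ≡₂ 1ℤ → Odd x
  ⇒odd x≡₂1 2∣x = even-odd-absurd (Equivalence.to ∣⇔≡₂0 2∣x) x≡₂1

-- The coefficient sum

opaque
  -- S x is x evaluated at ζ = 1, multiplicative modulo 2 as x⁸ + 1 ≡ (x + 1)⁸.  S is opaque because
  -- unifying against an unfolded coefficient sum makes Agda normalise the summands.
  S : R → ℤ
  S = sumFin

  sumFin≡S : ∀ x → sumFin x ≡ S x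
  sumFin≡S x = refl

  S-cong : ∀ {x y} → x ≈ y → S x ≡ S y
  S-cong x≈y = sumFin-cong (at x≈y)

  S-+ : ∀ x y → S (x +R y) ≡ S x + S y
  S-+ = sumFin-+

  S-scale : ∀ c x → S (scaleR c x) ≡ c * S x
  S-scale = sumFin-*ˡ

  S-0R : S 0R ≡ 0ℤ
  S-0R = refl

  S-1R : S 1R ≡ 1ℤ
  S-1R = refl

  S-ζ : S ζ ≡ 1ℤ
  S-ζ = refl

  S-negR-1R : S (negR 1R) ≡ -1ℤ
  S-negR-1R = refl

  S-e*e : ∀ i j → S (e i *R e j) ≡₂ 1ℤ
  S-e*e = from-yes (all? λ i → all? λ j → S (e i *R e j) ≡₂? 1ℤ)

  S-rational : ∀ {z} → IsRational z → S z ≡ z fz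
  S-rational {z} z-rational = begin
    z fz + sumFin (λ j → z (fs j))   ≡⟨ cong (λ s → z fz + s) (≡.trans (sumFin-cong z-rational) (sumFin-zero 7)) ⟩
    z fz + 0ℤ                        ≡⟨ ℤ.+-identityʳ (z fz) ⟩
    z fz                             ∎
    where open ≡-Reasoning

S-sumR : ∀ {n} (f : Fin n → R) → S (sumR f) ≡ sumFin (λ i → S (f i))
S-sumR {zero}  f = S-0R
S-sumR {suc n} f = ≡.trans (S-+ (f fz) (sumR (λ i → f (fs i))))
                           (cong (λ s → S (f fz) + s) (S-sumR (λ i → f (fs i))))

S-lincomb : ∀ {n} (c : Fin n → ℤ) v → S (lincomb c v) ≡ sumFin (λ k → c k * S (v k))
S-lincomb c v = ≡.trans (S-sumR (λ k → scaleR (c k) (v k))) (sumFin-cong (λ k → S-scale (c k) (v k)))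

S-linear : ∀ {F} → IsLinear F → ∀ x → S (F x) ≡ sumFin (λ i → x i * S (F (e i)))
S-linear {F} lF x = ≡.trans (S-cong (≈-trans (≈-cong lF (≈-sym (lincomb-e x))) (linear-lincomb lF x e)))
                            (S-lincomb x (λ i → F (e i)))

S-* : ∀ x y → S (x *R y) ≡₂ S x * S y
S-* x y = begin
  S (x *R y)                               ≡⟨ S-linear (*R-linearˡ y) x ⟩
  sumFin (λ i → x i * S (e i *R y))        ≈⟨ ≡₂-weighted-sum x (λ i → S (e i *R y)) (λ _ → S y) S-e*y ⟩
  sumFin (λ i → x i * S y)                 ≡⟨ sumFin-cong (λ i → ℤ.*-comm (x i) (S y)) ⟩
  sumFin (λ i → S y * x i)                 ≡⟨ sumFin-*ˡ (S y) x ⟩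
  S y * sumFin x                           ≡⟨ cong (S y *_) (sumFin≡S x) ⟩
  S y * S x                                ≡⟨ ℤ.*-comm (S y) (S x) ⟩
  S x * S y                                ∎
  where
  open import Relation.Binary.Reasoning.Setoid ≡₂-setoid
  S-e*y : ∀ i → S (e i *R y) ≡₂ S y
  S-e*y i = begin
    S (e i *R y)                           ≡⟨ S-linear (*R-linearʳ (e i)) y ⟩
    sumFin (λ j → y j * S (e i *R e j))    ≈⟨ ≡₂-weighted-sum y (λ j → S (e i *R e j)) (λ _ → 1ℤ) (S-e*e i) ⟩
    sumFin (λ j → y j * 1ℤ)                ≡⟨ sumFin-cong (λ j → ℤ.*-identityʳ (y j)) ⟩
    sumFin y                               ≡⟨ sumFin≡S y ⟩
    S y                                    ∎

S-powR : ∀ {z} → S z ≡₂ 1ℤ → ∀ n → S (powR z n) ≡₂ 1ℤ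
S-powR Sz≡₂1 zero    = ≡₂-reflexive S-1R
S-powR {z} Sz≡₂1 (suc n) = ≡₂-trans (S-* z (powR z n)) (≡₂-* Sz≡₂1 (S-powR Sz≡₂1 n))

S-powR-ζ : ∀ l → S (powR ζ l) ≡₂ 1ℤ
S-powR-ζ = S-powR {ζ} (≡₂-reflexive S-ζ)

S-evalF : ∀ a {z} → S z ≡₂ 1ℤ → S (evalF a z) ≡₂ sumFin a
S-evalF a {z} Sz≡₂1 = begin
  S (evalF a z)                              ≡⟨ S-lincomb a (λ k → powR z (toℕ k)) ⟩
  sumFin (λ k → a k * S (powR z (toℕ k)))
    ≈⟨ ≡₂-weighted-sum a (λ k → S (powR z (toℕ k))) (λ _ → 1ℤ) (λ k → S-powR Sz≡₂1 (toℕ k)) ⟩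
  sumFin (λ k → a k * 1ℤ)                    ≡⟨ sumFin-cong (λ k → ℤ.*-identityʳ (a k)) ⟩
  sumFin a                                   ∎
  where open import Relation.Binary.Reasoning.Setoid ≡₂-setoid

S-∏ : ∀ {u c} → (∀ l → S (u l) ≡₂ c) → ∀ L → S (∏ u L) ≡₂ c ^ length L
S-∏ Su≡₂c []      = ≡₂-reflexive S-1R
S-∏ {u} {c} Su≡₂c (l ∷ L) = ≡₂-trans (S-* (u l) (∏ u L))
  (≡₂-* {S (u l)} {c} {S (∏ u L)} {c ^ length L} (Su≡₂c l) (S-∏ Su≡₂c L))

N-parity : ∀ a d → Stable (orbit d) → N a d ≡₂ sumFin a ^ length (orbit d)
N-parity a d stable = begin
  N a d                                           ≡⟨ cong (λ z → z fz) (prodN≡∏ a d) ⟩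
  ∏ (λ l → evalF a (powR ζ l)) (orbit d) fz
    ≡⟨ S-rational {∏ (λ l → evalF a (powR ζ l)) (orbit d)} (∏-orbit-rational a stable) ⟨
  S (∏ (λ l → evalF a (powR ζ l)) (orbit d))
    ≈⟨ S-∏ {λ l → evalF a (powR ζ l)} (λ l → S-evalF a {powR ζ l} (S-powR-ζ l)) (orbit d) ⟩
  sumFin a ^ length (orbit d)                     ∎
  where open import Relation.Binary.Reasoning.Setoid ≡₂-setoid

-- Halving N_d when f(1) is even

geom : R → ℕ → R
geom z zero    = 0R
geom z (suc n) = powR z n +R geom z n

powR-geom : ∀ z n → powR z n ≈ 1R +R ((z -R 1R) *R geom z n)
powR-geom z zero    = pointwise λ k →
  ≡.sym (≡.trans (cong (λ s → 1R k + s) (at (zeroʳ (z -R 1R)) k)) (ℤ.+-identityʳ (1R k)))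
  where open CommutativeRing ℤ[ζ₁₆] using (zeroʳ)
powR-geom z (suc n) = ≈-sym (begin
  1R +R ((z -R 1R) *R (powR z n +R geom z n))
    ≈⟨ +R-cong {1R} {1R} ≈-refl (+-homo (*R-linearʳ (z -R 1R)) (powR z n) (geom z n)) ⟩
  1R +R (((z -R 1R) *R powR z n) +R ((z -R 1R) *R geom z n))
    ≈⟨ pointwise (λ k → swap (1R k) (((z -R 1R) *R powR z n) k) (((z -R 1R) *R geom z n) k)) ⟩
  (1R +R ((z -R 1R) *R geom z n)) +R ((z -R 1R) *R powR z n)
    ≈⟨ +R-cong {powR z n} {1R +R ((z -R 1R) *R geom z n)} (powR-geom z n) ≈-refl ⟨
  powR z n +R ((z -R 1R) *R powR z n)
    ≈⟨ +R-cong {1R *R powR z n} {powR z n} (*R-identityˡ (powR z n)) ≈-refl ⟨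
  (1R *R powR z n) +R ((z -R 1R) *R powR z n)
    ≈⟨ +-homo (*R-linearˡ (powR z n)) 1R (z -R 1R) ⟨
  (1R +R (z -R 1R)) *R powR z n
    ≈⟨ ≈-cong (*R-linearˡ (powR z n)) {1R +R (z -R 1R)} {z} (pointwise λ k → 1+[z-1] (1R k) (z k)) ⟩
  z *R powR z n ∎)
  where
  open import Relation.Binary.Reasoning.Setoid R-setoid
  swap : ∀ a b c → a + (b + c) ≡ (a + c) + b
  swap = solve-∀
  1+[z-1] : ∀ o z → o + (z + - o) ≡ z
  1+[z-1] = solve-∀

lincomb-+ʳ : ∀ {n} (c : Fin n → ℤ) v w → lincomb c (λ k → v k +R w k) ≈ lincomb c v +R lincomb c w
lincomb-+ʳ c v w = pointwise λ j → begin
  lincomb c (λ k → v k +R w k) j                   ≡⟨ lincomb-apply c (λ k → v k +R w k) j ⟩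
  sumFin (λ k → c k * (v k j + w k j))             ≡⟨ sumFin-cong (λ k → ℤ.*-distribˡ-+ (c k) (v k j) (w k j)) ⟩
  sumFin (λ k → c k * v k j + c k * w k j)         ≡⟨ sumFin-+ (λ k → c k * v k j) (λ k → c k * w k j) ⟩
  sumFin (λ k → c k * v k j) + sumFin (λ k → c k * w k j)
                                                   ≡⟨ cong₂ _+_ (lincomb-apply c v j) (lincomb-apply c w j) ⟨
  lincomb c v j + lincomb c w j                    ∎
  where open ≡-Reasoning

lincomb-const : ∀ {n} (c : Fin n → ℤ) x → lincomb c (λ _ → x) ≈ scaleR (sumFin c) x
lincomb-const c x = pointwise λ j → begin
  lincomb c (λ _ → x) j        ≡⟨ lincomb-apply c (λ _ → x) j ⟩
  sumFin (λ k → c k * x j)     ≡⟨ sumFin-cong (λ k → ℤ.*-comm (c k) (x j)) ⟩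
  sumFin (λ k → x j * c k)     ≡⟨ sumFin-*ˡ (x j) c ⟩
  x j * sumFin c               ≡⟨ ℤ.*-comm (x j) (sumFin c) ⟩
  sumFin c * x j               ∎
  where open ≡-Reasoning

-- Q a z = (f(z) − f(1))/(z − 1), so that Q a 1 = f′(1)
Q : (Fin 16 → ℤ) → R → R
Q a z = lincomb a (λ k → geom z (toℕ k))

evalF-expand-at-1 : ∀ a z → evalF a z ≈ scaleR (sumFin a) 1R +R ((z -R 1R) *R Q a z)
evalF-expand-at-1 a z = begin
  evalF a z
    ≈⟨ lincomb-congʳ a {λ k → powR z (toℕ k)} {λ k → 1R +R ((z -R 1R) *R geom z (toℕ k))}
                       (λ k → powR-geom z (toℕ k)) ⟩
  lincomb a (λ k → 1R +R ((z -R 1R) *R geom z (toℕ k)))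
    ≈⟨ lincomb-+ʳ a (λ _ → 1R) (λ k → (z -R 1R) *R geom z (toℕ k)) ⟩
  lincomb a (λ _ → 1R) +R lincomb a (λ k → (z -R 1R) *R geom z (toℕ k))
    ≈⟨ +R-cong (lincomb-const a 1R) (≈-sym (linear-lincomb (*R-linearʳ (z -R 1R)) a (λ k → geom z (toℕ k)))) ⟩
  scaleR (sumFin a) 1R +R ((z -R 1R) *R Q a z) ∎
  where open import Relation.Binary.Reasoning.Setoid R-setoid

c₁ : (Fin 16 → ℤ) → ℤ
c₁ a = sumFin (λ k → a k * + toℕ k)

S-geom : ∀ {z} → S z ≡₂ 1ℤ → ∀ n → S (geom z n) ≡₂ + n
S-geom Sz≡₂1 zero        = ≡₂-reflexive S-0R
S-geom {z} Sz≡₂1 (suc n) = ≡₂-trans (≡₂-reflexive (S-+ (powR z n) (geom z n)))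
                                    (≡₂-+ (S-powR Sz≡₂1 n) (S-geom Sz≡₂1 n))

S-Q : ∀ a {z} → S z ≡₂ 1ℤ → S (Q a z) ≡₂ c₁ a
S-Q a {z} Sz≡₂1 = ≡₂-trans (≡₂-reflexive (S-lincomb a (λ k → geom z (toℕ k))))
  (≡₂-weighted-sum a (λ k → S (geom z (toℕ k))) (λ k → + toℕ k) (λ k → S-geom Sz≡₂1 (toℕ k)))

π : ℕ → R
π l = ζ^ l -R 1R

π≈powR-ζ-1 : ∀ l → π l ≈ powR ζ l -R 1R
π≈powR-ζ-1 l = +R-cong {ζ^ l} {powR ζ l} (≈-sym (powR-ζ l)) ≈-refl

S-π : ∀ l → S (π l) ≡₂ 0ℤ
S-π l = ≡₂-trans (≡₂-reflexive (≡.trans (S-cong (π≈powR-ζ-1 l)) (S-+ (powR ζ l) (negR 1R))))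
                 (≡₂-+ (S-powR-ζ l) (≡₂-reflexive S-negR-1R))

evalF-ζ-factor : ∀ a m l w → sumFin a ≡ + 2 * m → π l *R w ≈ scaleR (+ 2) 1R →
                 evalF a (powR ζ l) ≈ π l *R (scaleR m w +R Q a (powR ζ l))
evalF-ζ-factor a m l w c₀≡2m πw≈2 = ≈-sym (begin
  π l *R (scaleR m w +R Q a (powR ζ l))
    ≈⟨ +-homo (*R-linearʳ (π l)) (scaleR m w) (Q a (powR ζ l)) ⟩
  (π l *R scaleR m w) +R (π l *R Q a (powR ζ l))
    ≈⟨ +R-cong {π l *R scaleR m w} {scaleR m (π l *R w)} (scale-homo (*R-linearʳ (π l)) m w) ≈-refl ⟩
  scaleR m (π l *R w) +R (π l *R Q a (powR ζ l))
    ≈⟨ +R-cong {scaleR m (π l *R w)} {scaleR (sumFin a) 1R} (pointwise scaled-2)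
               (≈-cong (*R-linearˡ (Q a (powR ζ l))) {π l} {powR ζ l -R 1R} (π≈powR-ζ-1 l)) ⟩
  scaleR (sumFin a) 1R +R ((powR ζ l -R 1R) *R Q a (powR ζ l))
    ≈⟨ evalF-expand-at-1 a (powR ζ l) ⟨
  evalF a (powR ζ l) ∎)
  where
  open import Relation.Binary.Reasoning.Setoid R-setoid
  reassoc : ∀ m o → m * (+ 2 * o) ≡ + 2 * m * o
  reassoc = solve-∀
  scaled-2 : ∀ k → m * (π l *R w) k ≡ sumFin a * 1R k
  scaled-2 k = ≡.trans (cong (m *_) (at πw≈2 k))
                       (≡.trans (reassoc m (1R k)) (cong (_* 1R k) (≡.sym c₀≡2m)))

∈⇒↭∷ : ∀ {l : ℕ} {L} → l ∈ L → Σ (List ℕ) λ M → L ↭ l ∷ M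
∈⇒↭∷ {l} l∈L with ys , zs , refl ← ∈-∃++ l∈L = ys ++ zs , shift l ys zs

π-cofactor : ∀ {l L} → l ∈ L → ∏ π L ≈ scaleR (+ 2) 1R → 1 ℕ.< length L →
             Σ R λ w → π l *R w ≈ scaleR (+ 2) 1R × S w ≡₂ 0ℤ
π-cofactor {l} {L} l∈L ∏π≈2 1<|L| with M , L↭l∷M ← ∈⇒↭∷ l∈L =
  ∏ π M ,
  ≈-trans (≈-sym (∏-↭ π L↭l∷M)) ∏π≈2 ,
  ≡₂-trans (S-∏ S-π M) (≡₂-reflexive (0^ (length M) 0<|M|))
  where
  0^ : ∀ n → 0 ℕ.< n → 0ℤ ^ n ≡ 0ℤ
  0^ (suc n) _ = refl
  0<|M| : 0 ℕ.< length M
  0<|M| = ℕ.s<s⁻¹ (≡.subst (1 ℕ.<_) (↭-length L↭l∷M) 1<|L|)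

∏-factorise : ∀ {u v c} L → All (λ l → Σ R λ y → u l ≈ v l *R y × S y ≡₂ c) L →
              Σ R λ Y → ∏ u L ≈ ∏ v L *R Y × S Y ≡₂ c ^ length L
∏-factorise []      []                          = 1R , ≈-sym (*R-identityˡ 1R) , ≡₂-reflexive S-1R
∏-factorise {u} {v} {c} (l ∷ L) ((y , u≈vy , Sy) ∷ ys) = extend (∏-factorise {u} {v} {c} L ys)
  where
  open CommutativeSemigroupProperties *-commutativeSemigroup using (interchange)
  extend : (Σ R λ Y → ∏ u L ≈ ∏ v L *R Y × S Y ≡₂ c ^ length L) →
           Σ R λ Y → ∏ u (l ∷ L) ≈ ∏ v (l ∷ L) *R Y × S Y ≡₂ c ^ length (l ∷ L)
  extend (Y , ∏u≈∏vY , SY) =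
    y *R Y ,
    ≈-trans (*R-cong {u l} {v l *R y} {∏ u L} {∏ v L *R Y} u≈vy ∏u≈∏vY) (interchange (v l) y (∏ v L) Y) ,
    ≡₂-trans (S-* y Y) (≡₂-* {S y} {c} {S Y} {c ^ length L} Sy SY)

-- Evaluated directly, ∏ recomputes every partial product once per coefficient of the next
-- factor; tabulating the partial products lets the type checker share them.
∏ᵗ : (ℕ → R) → List ℕ → R
∏ᵗ u = foldr (λ l acc → u l *R Vec.lookup (Vec.tabulate acc)) 1R

∏ᵗ≈∏ : ∀ u L → ∏ᵗ u L ≈ ∏ u L
∏ᵗ≈∏ u []      = ≈-refl
∏ᵗ≈∏ u (l ∷ L) = ≈-cong (*R-linearʳ (u l)) {Vec.lookup (Vec.tabulate (∏ᵗ u L))} {∏ u L}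
  (≈-trans (pointwise (Vec.lookup∘tabulate (∏ᵗ u L))) (∏ᵗ≈∏ u L))

-- for these d the product of the ζˡ − 1 over the orbit is Φ_{16/d}(1) = 2
halving-divisors : List ℕ
halving-divisors = 1 ∷ 2 ∷ 4 ∷ []

∏π-orbit≈2 : ∀ {d} → d ∈ halving-divisors → ∏ π (orbit d) ≈ scaleR (+ 2) 1R
∏π-orbit≈2 {d} d∈ = ≈-trans (≈-sym (∏ᵗ≈∏ π (orbit d))) (All.lookup computed d∈)
  where
  computed : All (λ d → ∏ᵗ π (orbit d) ≈ scaleR (+ 2) 1R) halving-divisors
  computed = from-yes (All.all? (λ d → ∏ᵗ π (orbit d) ≟R scaleR (+ 2) 1R) halving-divisors)

orbit-long : ∀ {d} → d ∈ halving-divisors → 1 ℕ.< length (orbit d)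
orbit-long = All.lookup (from-yes (All.all? (λ d → 1 ℕ.<? length (orbit d)) halving-divisors))

Halves : ℤ → ℕ → ℤ → Set
Halves c k n = Σ ℤ λ q → n ≡ + 2 * q × q ≡₂ c ^ k

evalF-ζ-split : ∀ a m {d l} → sumFin a ≡ + 2 * m → d ∈ halving-divisors → l ∈ orbit d →
                Σ R λ y → evalF a (powR ζ l) ≈ π l *R y × S y ≡₂ c₁ a
evalF-ζ-split a m {d} {l} c₀≡2m d∈ l∈L = split (π-cofactor l∈L (∏π-orbit≈2 d∈) (orbit-long d∈))
  where
  open import Relation.Binary.Reasoning.Setoid ≡₂-setoid
  split : (Σ R λ w → π l *R w ≈ scaleR (+ 2) 1R × S w ≡₂ 0ℤ) →
          Σ R λ y → evalF a (powR ζ l) ≈ π l *R y × S y ≡₂ c₁ a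
  split (w , πw≈2 , Sw≡₂0) =
    scaleR m w +R Q a (powR ζ l) ,
    evalF-ζ-factor a m l w c₀≡2m πw≈2 ,
    (begin
      S (scaleR m w +R Q a (powR ζ l))    ≡⟨ S-+ (scaleR m w) (Q a (powR ζ l)) ⟩
      S (scaleR m w) + S (Q a (powR ζ l)) ≡⟨ cong (_+ S (Q a (powR ζ l))) (S-scale m w) ⟩
      m * S w + S (Q a (powR ζ l))        ≈⟨ ≡₂-+ (≡₂-* (≡₂-refl {m}) Sw≡₂0) (S-Q a {powR ζ l} (S-powR-ζ l)) ⟩
      m * 0ℤ + c₁ a                       ≡⟨ cong (_+ c₁ a) (ℤ.*-zeroʳ m) ⟩
      0ℤ + c₁ a                           ≡⟨ ℤ.+-identityˡ (c₁ a) ⟩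
      c₁ a                                ∎)

N-half : ∀ a d m → sumFin a ≡ + 2 * m → Stable (orbit d) → d ∈ halving-divisors →
         Halves (c₁ a) (length (orbit d)) (N a d)
N-half a d m c₀≡2m stable d∈ =
  halve (∏-factorise {λ l → evalF a (powR ζ l)} {π} {c₁ a} (orbit d) (All.tabulate (evalF-ζ-split a m c₀≡2m d∈)))
  where
  open import Relation.Binary.Reasoning.Setoid R-setoid
  halve : (Σ R λ Y → ∏ (λ l → evalF a (powR ζ l)) (orbit d) ≈ ∏ π (orbit d) *R Y
                     × S Y ≡₂ c₁ a ^ length (orbit d)) →
          Halves (c₁ a) (length (orbit d)) (N a d)
  halve (Y , ∏≈∏πY , SY) =
    Y fz ,
    ≡.trans (cong (λ z → z fz) (prodN≡∏ a d)) (at ∏≈2Y fz) ,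
    ≡₂-trans (≡₂-reflexive (≡.sym (S-rational Y-rational))) SY
    where
    ∏≈2Y : ∏ (λ l → evalF a (powR ζ l)) (orbit d) ≈ scaleR (+ 2) Y
    ∏≈2Y = begin
      ∏ (λ l → evalF a (powR ζ l)) (orbit d)  ≈⟨ ∏≈∏πY ⟩
      ∏ π (orbit d) *R Y
        ≈⟨ ≈-cong (*R-linearˡ Y) {∏ π (orbit d)} {scaleR (+ 2) 1R} (∏π-orbit≈2 d∈) ⟩
      scaleR (+ 2) 1R *R Y                    ≈⟨ scale-homo (*R-linearˡ Y) (+ 2) 1R ⟩
      scaleR (+ 2) (1R *R Y)                  ≈⟨ pointwise (λ k → cong (+ 2 *_) (at (*R-identityˡ Y) k)) ⟩
      scaleR (+ 2) Y                          ∎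
    Y-rational : IsRational Y
    Y-rational j = ℤ.*-cancelˡ-≡ (+ 2) (Y (fs j)) 0ℤ
      (≡.trans (≡.sym (at ∏≈2Y (fs j))) (∏-orbit-rational a stable j))

-- Odd multiples of powers of 2

even⇒double : ∀ {x} → x ≡₂ 0ℤ → Σ ℤ λ m → x ≡ + 2 * m
even⇒double {x} (mod₂ (Signed.divides m x-0≡m2)) =
  m , ≡.trans (≡.sym (ℤ.+-identityʳ x)) (≡.trans x-0≡m2 (ℤ.*-comm m (+ 2)))

double⇒even : ∀ {x} m → x ≡ + 2 * m → x ≡₂ 0ℤ
double⇒even {x} m x≡2m = mod₂ (Signed.divides m (≡.trans (ℤ.+-identityʳ x) (≡.trans x≡2m (ℤ.*-comm (+ 2) m))))

¬InOddMul-odd : ∀ c {x} → x ≡₂ 1ℤ → ¬ InOddMul (+ 2 * c) x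
¬InOddMul-odd c {x} x≡₂1 (n , _ , x≡2cn) =
  even-odd-absurd (double⇒even (c * n) (≡.trans x≡2cn (ℤ.*-assoc (+ 2) c n))) x≡₂1

¬InOddMul-double : ∀ c .{{_ : NonZero c}} m → ¬ InOddMul c (c * (+ 2 * m))
¬InOddMul-double c m (n , n-odd , c2m≡cn) =
  n-odd (Equivalence.from ∣⇔≡₂0 (double⇒even m (≡.sym (ℤ.*-cancelˡ-≡ c (+ 2 * m) n c2m≡cn))))

InOddMul-double-odd : ∀ {q} → q ≡₂ 1ℤ → InOddMul (+ 2) (+ 2 * q)
InOddMul-double-odd {q} q≡₂1 = q , Equivalence.from Odd⇔≡₂1 q≡₂1 , refl

odd-cancel : ∀ j {o y n} → o ≡₂ 1ℤ → o * y ≡ (+ 2) ^ j * n → Σ ℤ λ k → y ≡ (+ 2) ^ j * k × o * k ≡ n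
odd-cancel zero    {o} {y} {n} _ oy≡n = y , ≡.sym (ℤ.*-identityˡ y) , ≡.trans oy≡n (ℤ.*-identityˡ n)
odd-cancel (suc j) {o} {y} {n} o≡₂1 oy≡2ʲ⁺¹n with parity y
... | inj₂ y≡₂1 = ⊥-elim (even-odd-absurd oy-even (≡₂-* o≡₂1 y≡₂1))
  where
  oy-even : o * y ≡₂ 0ℤ
  oy-even = double⇒even ((+ 2) ^ j * n) (≡.trans oy≡2ʲ⁺¹n (ℤ.*-assoc (+ 2) ((+ 2) ^ j) n))
... | inj₁ y≡₂0 with y′ , y≡2y′ ← even⇒double y≡₂0 =
  lift (odd-cancel j o≡₂1 (ℤ.*-cancelˡ-≡ (+ 2) (o * y′) ((+ 2) ^ j * n) halve))
  where
  halve : + 2 * (o * y′) ≡ + 2 * ((+ 2) ^ j * n)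
  halve = ≡.trans (x∙yz≈y∙xz (+ 2) o y′)
                  (≡.trans (cong (o *_) (≡.sym y≡2y′)) (≡.trans oy≡2ʲ⁺¹n (ℤ.*-assoc (+ 2) ((+ 2) ^ j) n)))
    where open CommutativeSemigroupProperties ℤ.*-commutativeSemigroup using (x∙yz≈y∙xz)
  lift : (Σ ℤ λ k → y′ ≡ (+ 2) ^ j * k × o * k ≡ n) → Σ ℤ λ k → y ≡ (+ 2) ^ suc j * k × o * k ≡ n
  lift (k , y′≡2ʲk , ok≡n) =
    k , ≡.trans y≡2y′ (≡.trans (cong (+ 2 *_) y′≡2ʲk) (≡.sym (ℤ.*-assoc (+ 2) ((+ 2) ^ j) k))) , ok≡n

InOddMul-cancelˡ : ∀ j {x y} → InOddMul (+ 2) x → InOddMul ((+ 2) ^ suc j) (x * y) ⇔ InOddMul ((+ 2) ^ j) y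
InOddMul-cancelˡ j {x} {y} (o , o-odd , x≡2o) = mk⇔ to from
  where
  o≡₂1 : o ≡₂ 1ℤ
  o≡₂1 = Equivalence.to Odd⇔≡₂1 o-odd
  reassoc : ∀ a b c d → a * b * (c * d) ≡ a * c * (b * d)
  reassoc = solve-∀
  to : InOddMul ((+ 2) ^ suc j) (x * y) → InOddMul ((+ 2) ^ j) y
  to (n , n-odd , xy≡2ʲ⁺¹n)
    with k , y≡2ʲk , ok≡n ← odd-cancel j o≡₂1 (ℤ.*-cancelˡ-≡ (+ 2) (o * y) ((+ 2) ^ j * n)
           (≡.trans (≡.sym (ℤ.*-assoc (+ 2) o y))
                    (≡.trans (cong (_* y) (≡.sym x≡2o)) (≡.trans xy≡2ʲ⁺¹n (ℤ.*-assoc (+ 2) ((+ 2) ^ j) n)))))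
    = k , k-odd , y≡2ʲk
    where
    k-odd : Odd k
    k-odd 2∣k = even-odd-absurd
      (≡₂-trans (≡₂-reflexive (≡.sym ok≡n)) (≡₂-trans (≡₂-* (≡₂-refl {o}) (Equivalence.to (∣⇔≡₂0 {k}) 2∣k))
                                                      (≡₂-reflexive (ℤ.*-zeroʳ o))))
      (Equivalence.to Odd⇔≡₂1 n-odd)
  from : InOddMul ((+ 2) ^ j) y → InOddMul ((+ 2) ^ suc j) (x * y)
  from (n , n-odd , y≡2ʲn) =
    o * n ,
    Equivalence.from Odd⇔≡₂1 (≡₂-* o≡₂1 (Equivalence.to Odd⇔≡₂1 n-odd)) ,
    ≡.trans (cong₂ _*_ x≡2o y≡2ʲn) (reassoc (+ 2) o ((+ 2) ^ j) n)

InOddMul-resp : ∀ c {x y} → x ≡ y → InOddMul c x ⇔ InOddMul c y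
InOddMul-resp c refl = ⇔.refl

⇔-absurd : ∀ {A B : Set} → ¬ A → ¬ B → A ⇔ B
⇔-absurd ¬a ¬b = mk⇔ (λ a → ⊥-elim (¬a a)) (λ b → ⊥-elim (¬b b))

conditions-equivalent :
  ∀ n₁ n₂ n₄ n₈ n₁₆ →
  (¬ InOddMul (+ 2) n₁ × ¬ InOddMul (+ 64) (n₁ * n₂ * n₄ * n₈ * n₁₆))
  ⊎ (InOddMul (+ 2) n₁ × InOddMul (+ 2) n₂ × InOddMul (+ 2) n₄) →
  (InOddMul (+ 64) (n₁ * n₂ * n₄ * n₈ * n₁₆) ⇔
     (InOddMul (+ 2) n₁ × InOddMul (+ 2) n₂ × InOddMul (+ 16) (n₄ * n₈ * n₁₆))) ×
  (InOddMul (+ 64) (n₁ * n₂ * n₄ * n₈ * n₁₆) ⇔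
     (InOddMul (+ 2) n₁ × InOddMul (+ 2) n₂ × InOddMul (+ 2) n₄ × InOddMul (+ 8) (n₈ * n₁₆)))
conditions-equivalent n₁ n₂ n₄ n₈ n₁₆ (inj₁ (¬N₁ , ¬D)) =
  ⇔-absurd ¬D (λ c → ¬N₁ (proj₁ c)) , ⇔-absurd ¬D (λ c → ¬N₁ (proj₁ c))
conditions-equivalent n₁ n₂ n₄ n₈ n₁₆ (inj₂ (N₁ , N₂ , N₄)) =
  ⇔.trans C1⇔X (⇔.sym C2⇔X) , ⇔.trans C1⇔X (⇔.sym C3⇔X)
  where
  X = InOddMul (+ 8) (n₈ * n₁₆)
  reassoc₅ : ∀ a b c d e → a * b * c * d * e ≡ a * (b * (c * (d * e)))
  reassoc₅ = solve-∀
  reassoc₃ : ∀ c d e → c * d * e ≡ c * (d * e)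
  reassoc₃ = solve-∀
  N₄⇔ : InOddMul (+ 16) (n₄ * n₈ * n₁₆) ⇔ X
  N₄⇔ = ⇔.trans (InOddMul-resp (+ 16) (reassoc₃ n₄ n₈ n₁₆)) (InOddMul-cancelˡ 3 N₄)
  C1⇔X : InOddMul (+ 64) (n₁ * n₂ * n₄ * n₈ * n₁₆) ⇔ X
  C1⇔X = ⇔.trans (InOddMul-resp (+ 64) (reassoc₅ n₁ n₂ n₄ n₈ n₁₆))
           (⇔.trans (InOddMul-cancelˡ 5 N₁) (⇔.trans (InOddMul-cancelˡ 4 N₂) (InOddMul-cancelˡ 3 N₄)))
  C2⇔X : (InOddMul (+ 2) n₁ × InOddMul (+ 2) n₂ × InOddMul (+ 16) (n₄ * n₈ * n₁₆)) ⇔ X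
  C2⇔X = mk⇔ (λ c → Equivalence.to N₄⇔ (proj₂ (proj₂ c))) (λ x → N₁ , N₂ , Equivalence.from N₄⇔ x)
  C3⇔X : (InOddMul (+ 2) n₁ × InOddMul (+ 2) n₂ × InOddMul (+ 2) n₄ × X) ⇔ X
  C3⇔X = mk⇔ (λ c → proj₂ (proj₂ (proj₂ c))) (λ x → N₁ , N₂ , N₄ , x)

Halves-even : ∀ {c n} k → c ≡₂ 0ℤ → Halves c (suc k) n → Σ ℤ λ r → n ≡ + 2 * (+ 2 * r)
Halves-even {c} k c≡₂0 (q , n≡2q , q≡₂cᵏ) =
  map₂ (λ q≡2r → ≡.trans n≡2q (cong (+ 2 *_) q≡2r)) (even⇒double (≡₂-trans q≡₂cᵏ (≡₂-^ (suc k) c≡₂0)))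

Halves-odd : ∀ {c n} k → c ≡₂ 1ℤ → Halves c k n → InOddMul (+ 2) n
Halves-odd {c} {n} k c≡₂1 (q , n≡2q , q≡₂cᵏ) = Equivalence.from (InOddMul-resp (+ 2) n≡2q)
  (InOddMul-double-odd (≡₂-trans q≡₂cᵏ (≡₂-trans (≡₂-^ k c≡₂1) (≡₂-reflexive (ℤ.^-zeroˡ k)))))

shape-even-even : ∀ {c₁ n₁ n₂ n₄ n₈ n₁₆} → c₁ ≡₂ 0ℤ → n₁₆ ≡₂ 0ℤ →
                  Halves c₁ 8 n₁ → Halves c₁ 4 n₂ → Halves c₁ 2 n₄ →
                  ¬ InOddMul (+ 2) n₁ × ¬ InOddMul (+ 64) (n₁ * n₂ * n₄ * n₈ * n₁₆)
shape-even-even {n₁ = n₁} {n₂} {n₄} {n₈} {n₁₆} c₁≡₂0 n₁₆≡₂0 h₁ h₂ h₄ =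
  quarters (Halves-even 7 c₁≡₂0 h₁) (Halves-even 3 c₁≡₂0 h₂) (Halves-even 1 c₁≡₂0 h₄) (even⇒double n₁₆≡₂0)
  where
  collect : ∀ r₁ r₂ r₄ n₈ s → + 2 * (+ 2 * r₁) * (+ 2 * (+ 2 * r₂)) * (+ 2 * (+ 2 * r₄)) * n₈ * (+ 2 * s)
                              ≡ + 64 * (+ 2 * (r₁ * r₂ * r₄ * n₈ * s))
  collect = solve-∀
  quarters : (Σ ℤ λ r₁ → n₁ ≡ + 2 * (+ 2 * r₁)) → (Σ ℤ λ r₂ → n₂ ≡ + 2 * (+ 2 * r₂)) →
             (Σ ℤ λ r₄ → n₄ ≡ + 2 * (+ 2 * r₄)) → (Σ ℤ λ s → n₁₆ ≡ + 2 * s) →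
             ¬ InOddMul (+ 2) n₁ × ¬ InOddMul (+ 64) (n₁ * n₂ * n₄ * n₈ * n₁₆)
  quarters (r₁ , n₁≡4r₁) (r₂ , n₂≡4r₂) (r₄ , n₄≡4r₄) (s , n₁₆≡2s) =
    (λ N₁ → ¬InOddMul-double (+ 2) r₁ (Equivalence.to (InOddMul-resp (+ 2) n₁≡4r₁) N₁)) ,
    (λ D → ¬InOddMul-double (+ 64) (r₁ * r₂ * r₄ * n₈ * s) (Equivalence.to (InOddMul-resp (+ 64) D≡) D))
    where
    D≡ : n₁ * n₂ * n₄ * n₈ * n₁₆ ≡ + 64 * (+ 2 * (r₁ * r₂ * r₄ * n₈ * s))
    D≡ = ≡.trans (cong₂ (λ x y → x * n₈ * y) (cong₂ _*_ (cong₂ _*_ n₁≡4r₁ n₂≡4r₂) n₄≡4r₄) n₁₆≡2s)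
                 (collect r₁ r₂ r₄ n₈ s)

shape : ∀ c₀ c₁ n₁ n₂ n₄ n₈ n₁₆ →
        n₁ ≡₂ c₀ ^ 8 → n₂ ≡₂ c₀ ^ 4 → n₄ ≡₂ c₀ ^ 2 → n₈ ≡₂ c₀ ^ 1 → n₁₆ ≡₂ c₀ ^ 1 →
        (∀ m → c₀ ≡ + 2 * m → Halves c₁ 8 n₁ × Halves c₁ 4 n₂ × Halves c₁ 2 n₄) →
        (¬ InOddMul (+ 2) n₁ × ¬ InOddMul (+ 64) (n₁ * n₂ * n₄ * n₈ * n₁₆))
        ⊎ (InOddMul (+ 2) n₁ × InOddMul (+ 2) n₂ × InOddMul (+ 2) n₄)
shape c₀ c₁ n₁ n₂ n₄ n₈ n₁₆ n₁≡ n₂≡ n₄≡ n₈≡ n₁₆≡ halves with parity c₀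
... | inj₂ c₀≡₂1 = inj₁ (¬InOddMul-odd (+ 1) (odd 8 n₁≡) , ¬InOddMul-odd (+ 32) D-odd)
  where
  odd : ∀ {n} k → n ≡₂ c₀ ^ k → n ≡₂ 1ℤ
  odd k n≡₂c₀ᵏ = ≡₂-trans n≡₂c₀ᵏ (≡₂-trans (≡₂-^ k c₀≡₂1) (≡₂-reflexive (ℤ.^-zeroˡ k)))
  D-odd : n₁ * n₂ * n₄ * n₈ * n₁₆ ≡₂ 1ℤ
  D-odd = ≡₂-* (≡₂-* (≡₂-* (≡₂-* (odd 8 n₁≡) (odd 4 n₂≡)) (odd 2 n₄≡)) (odd 1 n₈≡)) (odd 1 n₁₆≡)
... | inj₁ c₀≡₂0 with even⇒double c₀≡₂0
...   | m , c₀≡2m with parity c₁ | halves m c₀≡2m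
...     | inj₁ c₁≡₂0 | h₁ , h₂ , h₄ =
  inj₁ (shape-even-even c₁≡₂0 (≡₂-trans n₁₆≡ (≡₂-^ 1 c₀≡₂0)) h₁ h₂ h₄)
...     | inj₂ c₁≡₂1 | h₁ , h₂ , h₄ =
  inj₂ (Halves-odd 8 c₁≡₂1 h₁ , Halves-odd 4 c₁≡₂1 h₂ , Halves-odd 2 c₁≡₂1 h₄)

theorem3p1 : (a : Fin 16 → ℤ) → (Cond1 a ⇔ Cond2 a) × (Cond1 a ⇔ Cond3 a)
theorem3p1 a = conditions-equivalent (N a 1) (N a 2) (N a 4) (N a 8) (N a 16)
  (shape (sumFin a) (c₁ a) (N a 1) (N a 2) (N a 4) (N a 8) (N a 16)
    (N-parity a 1  (orbit-stable (here refl)))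
    (N-parity a 2  (orbit-stable (there (here refl))))
    (N-parity a 4  (orbit-stable (there (there (here refl)))))
    (N-parity a 8  (orbit-stable (there (there (there (here refl))))))
    (N-parity a 16 (orbit-stable (there (there (there (there (here refl)))))))
    (λ m f1≡2m → N-half a 1 m f1≡2m (orbit-stable (here refl)) (here refl) ,
                 N-half a 2 m f1≡2m (orbit-stable (there (here refl))) (there (here refl)) ,
                 N-half a 4 m f1≡2m (orbit-stable (there (there (here refl)))) (there (there (here refl)))))
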